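{- For nonnegative integers $s,t,n$ with $s+t\le n$, we have $\mathrm{cp}(K_n\setminus(K_s\cup K_t))\ge st$.
   Context: $K_n\setminus(K_s\cup K_t)$ denotes the graph obtained from the complete graph $K_n$ by deleting the edges of two vertex-disjoint cliques, one on $s$ vertices and one on $t$ vertices. A clique partition of a graph $G$ is a collection of complete subgraphs of $G$ whose edge sets partition $E(G)$; $\mathrm{cp}(G)$ is the minimum number of cliques in a clique partition of $G$. -}

module Defs where

open import Data.Nat using (ℕ; _+_; _≤_; _<_)
open import Data.Fin using (Fin; toℕ)
open import Data.Fin.Subset using (Subset; _∈_)
open import Data.Product using (_×_; Σ)
open import Relation.Nullary using (¬_)
open import Relation.Binary.PropositionalEquality using (_≡_; _≢_)

-- The deleted clique K_s lives on the vertices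
-- {0,…,s-1}, the deleted clique K_t on {s,…,s+t-1} (vertex-disjoint; this
-- needs s + t ≤ n).  Up to isomorphism this is the graph K_n ∖ (K_s ∪ K_t).

InS : (s : ℕ) {n : ℕ} → Fin n → Set
InS s u = toℕ u < s

InT : (s t : ℕ) {n : ℕ} → Fin n → Set
InT s t u = s ≤ toℕ u × toℕ u < s + t

Adj : (s t : ℕ) {n : ℕ} → Fin n → Fin n → Set
Adj s t u v = u ≢ v × ¬ (InS s u × InS s v) × ¬ (InT s t u × InT s t v)

IsClique : (s t : ℕ) {n : ℕ} → Subset n → Set
IsClique s t C = ∀ u v → u ∈ C → v ∈ C → u ≢ v → Adj s t u v

IsCliquePartition : (s t : ℕ) {n m : ℕ} → (Fin m → Subset n) → Set
IsCliquePartition s t {n} {m} C =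
  (∀ i → IsClique s t (C i)) ×
  (∀ (u v : Fin n) → Adj s t u v →
     Σ (Fin m) λ i → u ∈ C i × v ∈ C i ×
       (∀ j → u ∈ C j → v ∈ C j → j ≡ i))

module Submission where

-- Let S = {0,…,s-1} and T = {s,…,s+t-1} be the vertex sets of
-- the two deleted cliques.  Every vertex of S is adjacent to every vertex of
-- T, so each of the s·t cross edges uv (u ∈ S, v ∈ T) lies in a unique clique
-- of the partition.  A clique of G contains at most one vertex of S (S is
-- independent in G) and at most one vertex of T, so the clique of a cross edge
-- determines both of its endpoints: the map "cross edge ↦ its clique" is
-- injective, whence s·t ≤ m.

open import Defs
open import Data.Nat using (ℕ; _+_; _*_; _≤_; _<_)
open import Data.Nat.Properties using (<-irrefl; <-≤-trans; m≤m+n; +-monoʳ-<)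
open import Data.Fin using (Fin; toℕ; _↑ˡ_; _↑ʳ_; inject≤; remQuot; combine)
open import Data.Fin.Subset using (Subset; _∈_)
open import Data.Fin.Properties
  using (_≟_; toℕ<n; toℕ-inject≤; toℕ-↑ˡ; toℕ-↑ʳ; ↑ˡ-injective; ↑ʳ-injective;
         inject≤-injective; combine-remQuot; injective⇒≤)
open import Data.Product using (_×_; _,_; proj₁; proj₂; uncurry)
open import Data.Empty using (⊥-elim)
open import Relation.Nullary using (yes; no)
open import Relation.Binary.PropositionalEquality
  using (_≡_; refl; sym; trans; cong; cong₂; subst; module ≡-Reasoning)

cross-adjacent : ∀ {s t n} {u v : Fin n} → InS s u → InT s t v → Adj s t u v
cross-adjacent {s} u∈S (s≤v , _) =
    (λ u≡v → <-irrefl refl (<-≤-trans (subst (λ w → InS s w) u≡v u∈S) s≤v))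
  , (λ (_ , v∈S) → <-irrefl refl (<-≤-trans v∈S s≤v))
  , (λ ((s≤u , _) , _) → <-irrefl refl (<-≤-trans u∈S s≤u))

clique-meets-S-once : ∀ {s t n} {C : Subset n} → IsClique s t C →
  ∀ {u v} → u ∈ C → v ∈ C → InS s u → InS s v → u ≡ v
clique-meets-S-once clique {u} {v} u∈C v∈C u∈S v∈S with u ≟ v
... | yes u≡v = u≡v
... | no  u≢v = ⊥-elim (proj₁ (proj₂ (clique u v u∈C v∈C u≢v)) (u∈S , v∈S))

clique-meets-T-once : ∀ {s t n} {C : Subset n} → IsClique s t C →
  ∀ {u v} → u ∈ C → v ∈ C → InT s t u → InT s t v → u ≡ v
clique-meets-T-once clique {u} {v} u∈C v∈C u∈T v∈T with u ≟ v
... | yes u≡v = u≡v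
... | no  u≢v = ⊥-elim (proj₂ (proj₂ (clique u v u∈C v∈C u≢v)) (u∈T , v∈T))

module CrossEdges {s t n m : ℕ} {C : Fin m → Subset n}
                  (partition : IsCliquePartition s t C) where

  cliqueOf : ∀ {u v} → InS s u → InT s t v → Fin m
  cliqueOf u∈S v∈T = proj₁ (proj₂ partition _ _ (cross-adjacent u∈S v∈T))

  left∈cliqueOf : ∀ {u v} (u∈S : InS s u) (v∈T : InT s t v) →
    u ∈ C (cliqueOf u∈S v∈T)
  left∈cliqueOf u∈S v∈T =
    proj₁ (proj₂ (proj₂ partition _ _ (cross-adjacent u∈S v∈T)))

  right∈cliqueOf : ∀ {u v} (u∈S : InS s u) (v∈T : InT s t v) →
    v ∈ C (cliqueOf u∈S v∈T)
  right∈cliqueOf u∈S v∈T =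
    proj₁ (proj₂ (proj₂ (proj₂ partition _ _ (cross-adjacent u∈S v∈T))))

  -- Two cross edges lying in the same clique are the same edge: that clique
  -- contains both S-endpoints and both T-endpoints.
  cliqueOf-injective : ∀ {u v u′ v′}
    (u∈S : InS s u) (v∈T : InT s t v) (u′∈S : InS s u′) (v′∈T : InT s t v′) →
    cliqueOf u∈S v∈T ≡ cliqueOf u′∈S v′∈T → u ≡ u′ × v ≡ v′
  cliqueOf-injective u∈S v∈T u′∈S v′∈T same =
      clique-meets-S-once clique (left∈cliqueOf u∈S v∈T) u′∈K u∈S u′∈S
    , clique-meets-T-once clique (right∈cliqueOf u∈S v∈T) v′∈K v∈T v′∈T
    where
      K = C (cliqueOf u∈S v∈T)
      clique = proj₁ partition (cliqueOf u∈S v∈T)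
      u′∈K : _ ∈ K
      u′∈K = subst (λ i → _ ∈ C i) (sym same) (left∈cliqueOf u′∈S v′∈T)
      v′∈K : _ ∈ K
      v′∈K = subst (λ i → _ ∈ C i) (sym same) (right∈cliqueOf u′∈S v′∈T)

module Embedding {s t n : ℕ} (s+t≤n : s + t ≤ n) where

  sVertex : Fin s → Fin n
  sVertex a = inject≤ (a ↑ˡ t) s+t≤n

  tVertex : Fin t → Fin n
  tVertex b = inject≤ (s ↑ʳ b) s+t≤n

  sVertex-injective : ∀ {a a′} → sVertex a ≡ sVertex a′ → a ≡ a′
  sVertex-injective eq = ↑ˡ-injective t _ _ (inject≤-injective _ _ _ _ eq)

  tVertex-injective : ∀ {b b′} → tVertex b ≡ tVertex b′ → b ≡ b′
  tVertex-injective eq = ↑ʳ-injective s _ _ (inject≤-injective _ _ _ _ eq)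

  sVertex∈S : ∀ a → InS s (sVertex a)
  sVertex∈S a = subst (_< s) (sym toℕ-sVertex) (toℕ<n a)
    where
      toℕ-sVertex : toℕ (sVertex a) ≡ toℕ a
      toℕ-sVertex = trans (toℕ-inject≤ (a ↑ˡ t) s+t≤n) (toℕ-↑ˡ a t)

  tVertex∈T : ∀ b → InT s t (tVertex b)
  tVertex∈T b rewrite toℕ-inject≤ (s ↑ʳ b) s+t≤n | toℕ-↑ʳ s b =
    m≤m+n s (toℕ b) , +-monoʳ-< s (toℕ<n b)

-- Counting: an injection Fin a × Fin b → Fin m forces a * b ≤ m, because
-- remQuot identifies Fin (a * b) with Fin a × Fin b.
pairs-injective⇒≤ : ∀ {a b m} (f : Fin a × Fin b → Fin m) →
  (∀ {p q} → f p ≡ f q → p ≡ q) → a * b ≤ m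
pairs-injective⇒≤ {a} {b} f f-injective =
  injective⇒≤ {f = λ x → f (remQuot {a} b x)} (λ eq → remQuot-injective (f-injective eq))
  where
    open ≡-Reasoning
    remQuot-injective : ∀ {x y : Fin (a * b)} → remQuot {a} b x ≡ remQuot b y → x ≡ y
    remQuot-injective {x} {y} eq = begin
      x                                 ≡⟨ sym (combine-remQuot {a} b x) ⟩
      uncurry combine (remQuot {a} b x) ≡⟨ cong (uncurry combine) eq ⟩
      uncurry combine (remQuot {a} b y) ≡⟨ combine-remQuot {a} b y ⟩
      y                                 ∎

lemma6p4 : (s t n : ℕ) → s + t ≤ n →
    (m : ℕ) (C : Fin m → Subset n) → IsCliquePartition s t C → s * t ≤ m
lemma6p4 s t n s+t≤n m C partition = pairs-injective⇒≤ cliqueOfPair injective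
  where
    open CrossEdges partition
    open Embedding {s} {t} s+t≤n

    cliqueOfPair : Fin s × Fin t → Fin m
    cliqueOfPair (a , b) = cliqueOf (sVertex∈S a) (tVertex∈T b)

    injective : ∀ {p q} → cliqueOfPair p ≡ cliqueOfPair q → p ≡ q
    injective {a , b} {a′ , b′} same
      with sa≡sa′ , tb≡tb′ ← cliqueOf-injective (sVertex∈S a) (tVertex∈T b)
                                              (sVertex∈S a′) (tVertex∈T b′) same
      = cong₂ _,_ (sVertex-injective sa≡sa′) (tVertex-injective tb≡tb′)
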